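{- Let $\theta$ be a substitution from $\mathcal{V}_{\mathrm{H}}$ to ground terms. Let $\rho$ be a substitution from $\mathcal{V}_{\mathrm{PG}}$ to ground terms such that $y\rho=y\mathfrak{q}(\theta)$ for all variables $y$ not introduced by $\mathfrak{p}(\theta)$. Then $\mathfrak{q}(\mathfrak{p}(\theta)\rho)=\rho$.
   Context: Setting: polymorphic higher-order logic with locally nameless terms (De Bruijn indices), constants with type arguments and parameters; terms are $\beta\eta$-classes of locally closed $\lambda$-preterms. A variable is functional if its type has the form $\tau\to\upsilon$, nonfunctional otherwise. Fix a $\beta\eta$-normalizer $\downarrow$ ($\beta$-normal $\eta$-long or $\beta$-normal $\eta$-short form). Orange positions of $\lambda$-preterms: $u|_\varepsilon=u$; if $u_i|_p=v$ then $(\mathsf{f}\langle\bar\tau\rangle(\bar s)\,\bar u_n)|_{i.p}=v$ and $(m\,\bar u_n)|_{i.p}=v$ for a De Bruijn index $m$ ($1\le i\le n$); if $u|_p=v$ then $(\lambda\langle\tau\rangle u)|_{1.p}=v$; for terms, $t|_p=s$ iff $(\downarrow t)|_p=\downarrow s$. Yellow subterms are orange subterms without free De Bruijn indices; yellow positions are orange positions identifying yellow subterms. Variables: $\mathcal{V}_{\mathrm{H}}$ is the given set of term variables; $\mathcal{V}_{\mathrm{PG}}=\mathcal{V}_{\mathrm{H}}\cup\{y_p\langle\tau\rangle\mid y\in\mathcal{V}_{\mathrm{H}},\ p \text{ a list of natural numbers},\ \tau \text{ a nonfunctional type}\}$. For a grounding substitution $\theta$ from $\mathcal{V}_{\mathrm{H}}$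 to ground terms: $\mathfrak{p}(\theta)$ is defined by $\alpha\mathfrak{p}(\theta)=\alpha\theta$ for type variables, and for $y\in\mathcal{V}_{\mathrm{H}}$, $y\mathfrak{p}(\theta)$ is the term obtained from $y\theta$ by replacing each outermost nonfunctional yellow subterm (i.e., not contained in another nonfunctional yellow subterm), at yellow position $p$, by the variable $y_p\in\mathcal{V}_{\mathrm{PG}}$; these $y_p$ are the variables introduced by $\mathfrak{p}(\theta)$. $\mathfrak{q}(\theta)$ maps $\mathcal{V}_{\mathrm{PG}}$ to ground terms by $y_p\mathfrak{q}(\theta)=y\theta|_p$ for each variable $y_p$ introduced by $\mathfrak{p}(\theta)$, and $y\mathfrak{q}(\theta)$ is some fixed arbitrary ground term (of the right type) independent of $\theta$ for all other $y\in\mathcal{V}_{\mathrm{PG}}$. Composition $\sigma\rho$ applies $\sigma$ first, then $\rho$. -}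

module Defs where

-- Polymorphic higher-order logic with locally nameless terms (De Bruijn indices),
-- constants with type arguments and parameters.  Terms (βη-classes) are represented
-- by their ↓-normal forms, which are β-normal, hence in spine form  h · args.

open import Data.Nat using (ℕ; zero; suc; pred; _≡ᵇ_; _<ᵇ_; _+_)
open import Data.Bool using (Bool; true; false; _∧_; _∨_; not; if_then_else_; T)
open import Data.List using (List; []; _∷_; _++_; _∷ʳ_; length; map)
open import Data.Maybe using (Maybe; just; nothing; fromMaybe; _>>=_)
open import Data.Product using (Σ; _×_; _,_)
open import Data.Unit using (⊤; tt)
open import Data.Empty using (⊥)
open import Relation.Binary.PropositionalEquality using (_≡_)

infixr 5 _⇒_
data Ty : Set where
  tv  : ℕ → Ty
  _⇒_ : Ty → Ty → Ty
  tc  : ℕ → List Ty → Ty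

nonFun : Ty → Bool
nonFun (_ ⇒ _) = false
nonFun _       = true

tsub  : (ℕ → Ty) → Ty → Ty
tsubs : (ℕ → Ty) → List Ty → List Ty
tsub s (tv i)    = s i
tsub s (a ⇒ b)   = tsub s a ⇒ tsub s b
tsub s (tc c ts) = tc c (tsubs s ts)
tsubs s []       = []
tsubs s (t ∷ ts) = tsub s t ∷ tsubs s ts

groundTy  : Ty → Bool
groundTys : List Ty → Bool
groundTy (tv _)    = false
groundTy (a ⇒ b)   = groundTy a ∧ groundTy b
groundTy (tc _ ts) = groundTys ts
groundTys []       = true
groundTys (t ∷ ts) = groundTy t ∧ groundTys ts

eqNs : List ℕ → List ℕ → Bool
eqNs []       []       = true
eqNs (m ∷ ms) (n ∷ ns) = (m ≡ᵇ n) ∧ eqNs ms ns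
eqNs _        _        = false

eqTy  : Ty → Ty → Bool
eqTys : List Ty → List Ty → Bool
eqTy (tv i)    (tv j)    = i ≡ᵇ j
eqTy (a ⇒ b)   (c ⇒ d)   = eqTy a c ∧ eqTy b d
eqTy (tc c ts) (tc d us) = (c ≡ᵇ d) ∧ eqTys ts us
eqTy _         _         = false
eqTys []       []       = true
eqTys (t ∷ ts) (u ∷ us) = eqTy t u ∧ eqTys ts us
eqTys _        _        = false

nth : {A : Set} → List A → ℕ → Maybe A
nth []       _       = nothing
nth (x ∷ xs) zero    = just x
nth (x ∷ xs) (suc n) = nth xs n

inst : List Ty → Ty → Ty
inst τs = tsub (λ i → fromMaybe (tv i) (nth τs i))

-- Signature: types of the term variables in V_H (V_H = ℕ) and of constants.
-- A constant f has cArity f type arguments, parameters of types cParams f and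
-- type cType f (schemes over the type variables 0 … cArity f - 1).

tvsBelow  : ℕ → Ty → Bool
tvsBelows : ℕ → List Ty → Bool
tvsBelow n (tv i)    = i <ᵇ n
tvsBelow n (a ⇒ b)   = tvsBelow n a ∧ tvsBelow n b
tvsBelow n (tc _ ts) = tvsBelows n ts
tvsBelows n []       = true
tvsBelows n (t ∷ ts) = tvsBelow n t ∧ tvsBelows n ts

record Signature : Set where
  field
    tyH     : ℕ → Ty
    cArity  : ℕ → ℕ
    cParams : ℕ → List Ty
    cType   : ℕ → Ty
    cType-wf   : (f : ℕ) → T (tvsBelow (cArity f) (cType f))
    cParams-wf : (f : ℕ) → T (tvsBelows (cArity f) (cParams f))

-- Variables  V_PG = V_H ∪ { y_p⟨τ⟩ | y ∈ V_H, p position, τ nonfunctional }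

data VPG : Set where
  base : ℕ → VPG
  sub  : ℕ → List ℕ → (τ : Ty) → T (nonFun τ) → VPG

-- β-normal preterms in spine form.  Heads: free variables, De Bruijn
-- indices (0-based), constants f⟨τ̄⟩(s̄).

data Head : Set
data PT : Set

data Head where
  fv : VPG → Head
  bv : ℕ → Head
  cn : ℕ → List Ty → List PT → Head

infix 6 _·_
data PT where
  lam : Ty → PT → PT
  _·_ : Head → List PT → PT

tsubT  : (ℕ → Ty) → PT → PT
tsubTs : (ℕ → Ty) → List PT → List PT
tsubT s (lam τ b)            = lam (tsub s τ) (tsubT s b)
tsubT s (fv v · as)          = fv v · tsubTs s as
tsubT s (bv i · as)          = bv i · tsubTs s as
tsubT s (cn f τs ps · as)    = cn f (tsubs s τs) (tsubTs s ps) · tsubTs s as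
tsubTs s []       = []
tsubTs s (t ∷ ts) = tsubT s t ∷ tsubTs s ts

shift  : ℕ → ℕ → PT → PT
shifts : ℕ → ℕ → List PT → List PT
shiftH : ℕ → ℕ → Head → Head
shift c d (lam τ b) = lam τ (shift (suc c) d b)
shift c d (h · as)  = shiftH c d h · shifts c d as
shiftH c d (fv v) = fv v
shiftH c d (bv i) = bv (if i <ᵇ c then i else i + d)
shiftH c d (cn f τs ps) = cn f τs (shifts c d ps)
shifts c d []       = []
shifts c d (t ∷ ts) = shift c d t ∷ shifts c d ts

down  : ℕ → PT → PT
downs : ℕ → List PT → List PT
downH : ℕ → Head → Head
down c (lam τ b) = lam τ (down (suc c) b)
down c (h · as)  = downH c h · downs c as
downH c (fv v) = fv v
downH c (bv i) = bv (if c <ᵇ i then pred i else i)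
downH c (cn f τs ps) = cn f τs (downs c ps)
downs c []       = []
downs c (t ∷ ts) = down c t ∷ downs c ts

occ  : ℕ → PT → Bool
occs : ℕ → List PT → Bool
occH : ℕ → Head → Bool
occ k (lam τ b) = occ (suc k) b
occ k (h · as)  = occH k h ∨ occs k as
occH k (fv v) = false
occH k (bv i) = i ≡ᵇ k
occH k (cn f τs ps) = occs k ps
occs k []       = false
occs k (t ∷ ts) = occ k t ∨ occs k ts

closedAt  : ℕ → PT → Bool
closedAts : ℕ → List PT → Bool
closedAtH : ℕ → Head → Bool
closedAt d (lam τ b) = closedAt (suc d) b
closedAt d (h · as)  = closedAtH d h ∧ closedAts d as
closedAtH d (fv v) = true
closedAtH d (bv i) = i <ᵇ d
closedAtH d (cn f τs ps) = closedAts d ps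
closedAts d []       = true
closedAts d (t ∷ ts) = closedAt d t ∧ closedAts d ts

groundT  : PT → Bool
groundTs : List PT → Bool
groundH  : Head → Bool
groundT (lam τ b) = groundTy τ ∧ groundT b
groundT (h · as)  = groundH h ∧ groundTs as
groundH (fv v) = false
groundH (bv i) = true
groundH (cn f τs ps) = groundTys τs ∧ groundTs ps
groundTs []       = true
groundTs (t ∷ ts) = groundT t ∧ groundTs ts

-- Hereditary substitution (β-normalisation of substitution instances).
-- hsub τ k a t : replace index k (of type τ) in t by a (shifted under binders),
-- decrementing the indices above k, and β-normalising the redexes created.

hsub  : Ty → ℕ → PT → PT → PT
hsubs : Ty → ℕ → PT → List PT → List PT
napp  : Ty → PT → List PT → PT
hsub τ k a (lam σ b)         = lam σ (hsub τ (suc k) a b)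
hsub τ k a (fv v · as)       = fv v · hsubs τ k a as
hsub τ k a (cn f τs ps · as) = cn f τs (hsubs τ k a ps) · hsubs τ k a as
hsub τ k a (bv i · as)       =
  if i ≡ᵇ k then napp τ (shift 0 k a) (hsubs τ k a as)
  else (if k <ᵇ i then bv (pred i) · hsubs τ k a as else bv i · hsubs τ k a as)
hsubs τ k a []       = []
hsubs τ k a (t ∷ ts) = hsub τ k a t ∷ hsubs τ k a ts
-- napp τ s as : β-normal form of  s as  where s : τ
napp (σ ⇒ τ) (lam _ b) (a ∷ as) = napp τ (hsub σ 0 a b) as
napp τ s []                     = s
napp τ (h · bs) as              = h · (bs ++ as)
napp τ s as                     = s          -- ill-typed: junk

etaExp : Ty → PT → PT
etaExp (σ ⇒ τ) (h · as) =
  lam σ (etaExp τ (shiftH 0 1 h · (shifts 0 1 as ∷ʳ etaExp σ (bv 0 · []))))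
etaExp _ t = t

initLast : {A : Set} → List A → Maybe (List A × A)
initLast [] = nothing
initLast (x ∷ []) = just ([] , x)
initLast (x ∷ y ∷ xs) with initLast (y ∷ xs)
... | just (ys , z) = just (x ∷ ys , z)
... | nothing       = nothing

isBv0 : PT → Bool
isBv0 (bv zero · []) = true
isBv0 _              = false

-- is  λ⟨σ⟩ b  an η-redex, i.e. b = u 0 with 0 not free in u ?
etaBody : PT → Bool
etaBody (lam _ _) = false
etaBody (h · as) with initLast as
... | nothing        = false
... | just (ini , l) = isBv0 l ∧ not (occ 0 (h · ini))

etaCut : PT → PT
etaCut (lam σ b) = lam σ b
etaCut (h · as) with initLast as
... | nothing        = h · as
... | just (ini , l) = down 0 (h · ini)

etaR  : PT → PT
etaRs : List PT → List PT
etaRH : Head → Head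
etaR (lam σ b) = if etaBody (etaR b) then etaCut (etaR b) else lam σ (etaR b)
etaR (h · as)  = etaRH h · etaRs as
etaRH (fv v) = fv v
etaRH (bv i) = bv i
etaRH (cn f τs ps) = cn f τs (etaRs ps)
etaRs []       = []
etaRs (t ∷ ts) = etaR t ∷ etaRs ts

short  : PT → Bool
shorts : List PT → Bool
shortH : Head → Bool
short (lam σ b) = short b ∧ not (etaBody b)
short (h · as)  = shortH h ∧ shorts as
shortH (fv v) = true
shortH (bv i) = true
shortH (cn f τs ps) = shorts ps
shorts []       = true
shorts (t ∷ ts) = short t ∧ shorts ts

-- The βη-normalizer ↓ is fixed to be either β-normal η-long or β-normal η-short.
data Mode : Set where
  long short′ : Mode

record Subst (V : Set) : Set where
  constructor ⟨_,_⟩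
  field
    ty : ℕ → Ty
    tm : V → PT
open Subst public

peel : ℕ → Ty → Maybe Ty
peel zero τ          = just τ
peel (suc n) (_ ⇒ τ) = peel n τ
peel (suc n) _       = nothing

-- positions (orange): u|_[] = u ; (f⟨τ̄⟩(s̄) ū)|_{i.p} = u_i|_p ; (m ū)|_{i.p} = u_i|_p ;
-- (λ u)|_{1.p} = u|_p   (argument positions are 1-based)
infixl 7 _at_
_at_ : PT → List ℕ → Maybe PT
t at [] = just t
lam σ b at (suc zero ∷ p) = b at p
(bv i · as) at (suc n ∷ p) = nth as n >>= λ u → u at p
(cn f τs ps · as) at (suc n ∷ p) = nth as n >>= λ u → u at p
_ at _ = nothing

nonFunTy : Ty → Maybe (Σ Ty (λ τ → T (nonFun τ)))
nonFunTy (tv i)    = just (tv i , tt)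
nonFunTy (_ ⇒ _)   = nothing
nonFunTy (tc c ts) = just (tc c ts , tt)

choose : {A B : Set} → Maybe A → (A → B) → B → B
choose (just a) f b = f a
choose nothing  f b = b

memIntro : List ℕ → Ty → List (List ℕ × Ty) → Bool
memIntro p τ [] = false
memIntro p τ ((q , σ) ∷ xs) = (eqNs p q ∧ eqTy τ σ) ∨ memIntro p τ xs

module _ (S : Signature) where
  open Signature S

  tyPG : VPG → Ty
  tyPG (base y)       = tyH y
  tyPG (sub _ _ τ _)  = τ

  -- typing.  Tm false Γ t τ : t has type τ in context Γ (types of the
  -- De Bruijn indices); Tm true additionally demands η-long form.

  LongOK : Bool → Ty → Set
  LongOK true  τ = T (nonFun τ)
  LongOK false τ = ⊤

  data Tm (ℓ : Bool) (Γ : List Ty) : PT → Ty → Set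
  data Hd (ℓ : Bool) (Γ : List Ty) : Head → Ty → Set
  data Sp (ℓ : Bool) (Γ : List Ty) : List PT → Ty → Ty → Set
  data Ps (ℓ : Bool) (Γ : List Ty) : List PT → List Ty → Set

  data Tm ℓ Γ where
    lamᵗ : ∀ {σ b τ} → Tm ℓ (σ ∷ Γ) b τ → Tm ℓ Γ (lam σ b) (σ ⇒ τ)
    appᵗ : ∀ {h as σ τ} → Hd ℓ Γ h σ → Sp ℓ Γ as σ τ → LongOK ℓ τ → Tm ℓ Γ (h · as) τ

  data Hd ℓ Γ where
    fvᵗ : ∀ {v} → Hd ℓ Γ (fv v) (tyPG v)
    bvᵗ : ∀ {i τ} → nth Γ i ≡ just τ → Hd ℓ Γ (bv i) τ
    cnᵗ : ∀ {f τs ps} → length τs ≡ cArity f → Ps ℓ Γ ps (map (inst τs) (cParams f))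
        → Hd ℓ Γ (cn f τs ps) (inst τs (cType f))

  data Sp ℓ Γ where
    []ᵗ  : ∀ {τ} → Sp ℓ Γ [] τ τ
    _∷ᵗ_ : ∀ {a as σ τ υ} → Tm ℓ Γ a σ → Sp ℓ Γ as τ υ → Sp ℓ Γ (a ∷ as) (σ ⇒ τ) υ

  data Ps ℓ Γ where
    []ᵗ  : Ps ℓ Γ [] []
    _∷ᵗ_ : ∀ {a as σ σs} → Tm ℓ Γ a σ → Ps ℓ Γ as σs → Ps ℓ Γ (a ∷ as) (σ ∷ σs)

  -- t is in ↓-normal form (t is assumed locally closed and of type τ)
  Normal : Mode → PT → Ty → Set
  Normal long   t τ = Tm true [] t τ
  Normal short′ t τ = T (short t)

  GroundTerm : Mode → PT → Ty → Set
  GroundTerm m t τ = T (groundTy τ) × T (groundT t) × Tm false [] t τ × Normal m t τ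

  GroundingH : Mode → Subst ℕ → Set
  GroundingH m θ = ((α : ℕ) → T (groundTy (ty θ α)))
                 × ((y : ℕ) → GroundTerm m (tm θ y) (tsub (ty θ) (tyH y)))

  GroundingPG : Mode → Subst VPG → Set
  GroundingPG m ρ = ((α : ℕ) → T (groundTy (ty ρ α)))
                  × ((v : VPG) → GroundTerm m (tm ρ v) (tsub (ty ρ) (tyPG v)))

  typeOf  : List Ty → PT → Maybe Ty
  typeOfH : List Ty → Head → Maybe Ty
  typeOf Γ (lam σ b) = typeOf (σ ∷ Γ) b >>= λ τ → just (σ ⇒ τ)
  typeOf Γ (h · as)  = typeOfH Γ h >>= peel (length as)
  typeOfH Γ (fv v) = just (tyPG v)
  typeOfH Γ (bv i) = nth Γ i
  typeOfH Γ (cn f τs ps) = just (inst τs (cType f))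

  longify  : List Ty → PT → PT
  longifys : List Ty → List PT → List PT
  longifyH : List Ty → Head → Head
  longify Γ (lam σ b) = lam σ (longify (σ ∷ Γ) b)
  longify Γ (h · as)  =
    choose (typeOf Γ (h · as)) (λ τ → etaExp τ (longifyH Γ h · longifys Γ as))
                                     (longifyH Γ h · longifys Γ as)
  longifyH Γ (fv v) = fv v
  longifyH Γ (bv i) = bv i
  longifyH Γ (cn f τs ps) = cn f τs (longifys Γ ps)
  longifys Γ []       = []
  longifys Γ (t ∷ ts) = longify Γ t ∷ longifys Γ ts

  nf : Mode → PT → PT
  nf long   t = longify [] t
  nf short′ t = etaR t

  applyS  : (ℕ → Ty) → (VPG → PT) → PT → PT
  applySs : (ℕ → Ty) → (VPG → PT) → List PT → List PT
  applyS st s (lam τ b)         = lam (tsub st τ) (applyS st s b)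
  applyS st s (fv v · as)       = napp (tsub st (tyPG v)) (s v) (applySs st s as)
  applyS st s (bv i · as)       = bv i · applySs st s as
  applyS st s (cn f τs ps · as) = cn f (tsubs st τs) (applySs st s ps) · applySs st s as
  applySs st s []       = []
  applySs st s (t ∷ ts) = applyS st s t ∷ applySs st s ts

  -- composition σρ (σ first, then ρ)
  compose : {V : Set} → Mode → Subst V → Subst VPG → Subst V
  compose m σ ρ = ⟨ (λ α → tsub (ty ρ) (ty σ α)) , (λ x → nf m (applyS (ty ρ) (tm ρ) (tm σ x))) ⟩

  -- yellow (no free De Bruijn index) and nonfunctional
  yellowNF : PT → Maybe (Σ Ty (λ τ → T (nonFun τ)))
  yellowNF t = if closedAt 0 t then (typeOf [] t >>= nonFunTy) else nothing

  -- replace outermost nonfunctional yellow subterms at position p by y_p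
  abstr     : ℕ → List ℕ → PT → PT
  abstrIn   : ℕ → List ℕ → PT → PT
  abstrArgs : ℕ → List ℕ → ℕ → List PT → List PT
  abstr y p t = choose (yellowNF t) (λ { (τ , pf) → fv (sub y p τ pf) · [] }) (abstrIn y p t)
  abstrIn y p (lam σ b)         = lam σ (abstr y (p ∷ʳ 1) b)
  abstrIn y p (bv i · as)       = bv i · abstrArgs y p 1 as
  abstrIn y p (cn f τs ps · as) = cn f τs ps · abstrArgs y p 1 as
  abstrIn y p (fv v · as)       = fv v · as
  abstrArgs y p n []       = []
  abstrArgs y p n (a ∷ as) = abstr y (p ∷ʳ n) a ∷ abstrArgs y p (suc n) as

  ony     : List ℕ → PT → List (List ℕ × Ty)
  onyIn   : List ℕ → PT → List (List ℕ × Ty)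
  onyArgs : List ℕ → ℕ → List PT → List (List ℕ × Ty)
  ony p t = choose (yellowNF t) (λ { (τ , _) → (p , τ) ∷ [] }) (onyIn p t)
  onyIn p (lam σ b)         = ony (p ∷ʳ 1) b
  onyIn p (bv i · as)       = onyArgs p 1 as
  onyIn p (cn f τs ps · as) = onyArgs p 1 as
  onyIn p (fv v · as)       = []
  onyArgs p n []       = []
  onyArgs p n (a ∷ as) = ony (p ∷ʳ n) a ++ onyArgs p (suc n) as

  𝔭 : Subst ℕ → Subst ℕ
  𝔭 θ = ⟨ ty θ , (λ y → abstr y [] (tm θ y)) ⟩

  isIntro : Subst ℕ → VPG → Bool
  isIntro θ (base y)       = false
  isIntro θ (sub y p τ _)  = memIntro p τ (ony [] (tm θ y))

  Introduced : Subst ℕ → VPG → Set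
  Introduced θ v = T (isIntro θ v)

  -- 𝔮(θ); dflt v τ is the fixed ground term (of ground type τ) used for
  -- the variables not introduced by 𝔭(θ)
  𝔮 : (VPG → Ty → PT) → Subst ℕ → Subst VPG
  𝔮 dflt θ = ⟨ ty θ , q ⟩
    where
      q : VPG → PT
      q (base y) = dflt (base y) (tsub (ty θ) (tyH y))
      q v@(sub y p τ _) =
        if isIntro θ v then fromMaybe (dflt v (tsub (ty θ) τ)) (tm θ y at p)
        else dflt v (tsub (ty θ) τ)

_≐_ : {V : Set} → Subst V → Subst V → Set
σ ≐ ρ = ((α : ℕ) → ty σ α ≡ ty ρ α) × ((v : _) → tm σ v ≡ tm ρ v)

{-# OPTIONS --safe #-}

-- Since θ(y) is ground, applying ρ to 𝔭(θ)(y) only instantiates the new variables: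
-- (𝔭(θ)ρ)(y) is θ(y) with the outermost nonfunctional yellow subterm at each position p
-- replaced by ρ(y_p), and it is already ↓-normal because θ(y) and the values of ρ are.
-- Each replacement is closed and has the same ground nonfunctional type as the subterm
-- it replaces, so the outermost nonfunctional yellow positions of (𝔭(θ)ρ)(y) are those
-- of θ(y).  Hence 𝔭(θ)ρ introduces exactly the variables θ introduces, with ρ(y_p) at
-- position p, and 𝔮(𝔭(θ)ρ) returns ρ(y_p) there; on all other variables it returns the
-- defaults of 𝔮(θ), which agree with ρ by hypothesis.

module Submission where

open import Defs
open import Data.Nat using (ℕ; zero; suc; _≡ᵇ_; _<ᵇ_; _+_; _≤_; z≤n; s≤s)
open import Data.Nat.Properties using (+-identityʳ; +-suc; ≡ᵇ⇒≡; <ᵇ⇒<; <⇒<ᵇ; m<n⇒m<1+n)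
open import Data.Bool using (true; false; T; _∧_; _∨_; not)
open import Data.Bool.Properties using (T-∧; T-∨; T-≡; T-not-≡; T-irrelevant)
open import Data.List using (List; []; _∷_; _++_; _∷ʳ_; length)
open import Data.List.Properties using (++-assoc; ++-identityʳ)
open import Data.List.Membership.Propositional using (_∈_)
open import Data.List.Membership.Propositional.Properties using (∈-++⁻)
open import Data.List.Relation.Unary.Any using (here; there)
open import Data.List.Relation.Binary.Pointwise using (Pointwise; []; _∷_)
open import Data.Maybe using (just; nothing; fromMaybe; _>>=_)
import Data.Maybe.Relation.Binary.Pointwise as Maybe
open import Data.Product using (∃-syntax; _×_; _,_; proj₁; proj₂)
import Data.Product.Relation.Binary.Pointwise.NonDependent as Product
open import Data.Sum using (inj₁; inj₂)
open import Function.Bundles using (module Equivalence)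
open import Relation.Binary.PropositionalEquality
  using (_≡_; refl; sym; trans; cong; cong₂; subst; module ≡-Reasoning)
open import Relation.Nullary using (¬_)

T-∧ˡ : ∀ {a b} → T (a ∧ b) → T a
T-∧ˡ {a} {b} t = proj₁ (Equivalence.to (T-∧ {a} {b}) t)

T-∧ʳ : ∀ {a b} → T (a ∧ b) → T b
T-∧ʳ {a} {b} t = proj₂ (Equivalence.to (T-∧ {a} {b}) t)

T-∧-intro : ∀ {a b} → T a → T b → T (a ∧ b)
T-∧-intro {a} {b} s t = Equivalence.from (T-∧ {a} {b}) (s , t)

T⇒≡true : ∀ {b} → T b → b ≡ true
T⇒≡true = Equivalence.to T-≡

≡true⇒T : ∀ {b} → b ≡ true → T b
≡true⇒T = Equivalence.from T-≡

≡ᵇ-false-below : ∀ i d k → T (i <ᵇ d) → d ≤ k → (i ≡ᵇ k) ≡ false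
≡ᵇ-false-below zero    (suc d) (suc k) _ _         = refl
≡ᵇ-false-below (suc i) (suc d) (suc k) l (s≤s d≤k) = ≡ᵇ-false-below i d k l d≤k

nth-just⇒<ᵇlength : ∀ {A : Set} (xs : List A) i {x} → nth xs i ≡ just x → T (i <ᵇ length xs)
nth-just⇒<ᵇlength (_ ∷ _)  zero    _ = _
nth-just⇒<ᵇlength (_ ∷ xs) (suc i) e = nth-just⇒<ᵇlength xs i e

initLast-pointwise : ∀ {A B : Set} {R : A → B → Set} {xs ys} → Pointwise R xs ys
  → Maybe.Pointwise (Product.Pointwise (Pointwise R) R) (initLast xs) (initLast ys)
initLast-pointwise [] = Maybe.nothing
initLast-pointwise (x∼y ∷ []) = Maybe.just ([] , x∼y)
initLast-pointwise {xs = _ ∷ x′ ∷ xs} {_ ∷ y′ ∷ ys} (x∼y ∷ rest@(_ ∷ _))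
  with initLast (x′ ∷ xs) | initLast (y′ ∷ ys) | initLast-pointwise rest
... | just _  | just _  | Maybe.just (inits , lasts) = Maybe.just (x∼y ∷ inits , lasts)
... | nothing | nothing | Maybe.nothing              = Maybe.nothing

tsub-ground  : ∀ s τ → T (groundTy τ) → tsub s τ ≡ τ
tsubs-ground : ∀ s τs → T (groundTys τs) → tsubs s τs ≡ τs
tsub-ground s (tv i)    ()
tsub-ground s (a ⇒ b)   g = cong₂ _⇒_ (tsub-ground s a (T-∧ˡ g)) (tsub-ground s b (T-∧ʳ {groundTy a} g))
tsub-ground s (tc c ts) g = cong (tc c) (tsubs-ground s ts g)
tsubs-ground s []       g = refl
tsubs-ground s (t ∷ ts) g = cong₂ _∷_ (tsub-ground s t (T-∧ˡ g)) (tsubs-ground s ts (T-∧ʳ {groundTy t} g))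

tsub-cong  : ∀ {s s′} → (∀ α → s α ≡ s′ α) → ∀ τ → tsub s τ ≡ tsub s′ τ
tsubs-cong : ∀ {s s′} → (∀ α → s α ≡ s′ α) → ∀ τs → tsubs s τs ≡ tsubs s′ τs
tsub-cong e (tv i)    = e i
tsub-cong e (a ⇒ b)   = cong₂ _⇒_ (tsub-cong e a) (tsub-cong e b)
tsub-cong e (tc c ts) = cong (tc c) (tsubs-cong e ts)
tsubs-cong e []       = refl
tsubs-cong e (t ∷ ts) = cong₂ _∷_ (tsub-cong e t) (tsubs-cong e ts)

groundTy-tsub  : ∀ s n τ → (∀ i → T (i <ᵇ n) → T (groundTy (s i)))
               → T (tvsBelow n τ) → T (groundTy (tsub s τ))
groundTys-tsubs : ∀ s n τs → (∀ i → T (i <ᵇ n) → T (groundTy (s i)))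
                → T (tvsBelows n τs) → T (groundTys (tsubs s τs))
groundTy-tsub s n (tv i)    gs b = gs i b
groundTy-tsub s n (a ⇒ c)   gs b =
  T-∧-intro (groundTy-tsub s n a gs (T-∧ˡ b)) (groundTy-tsub s n c gs (T-∧ʳ {tvsBelow n a} b))
groundTy-tsub s n (tc c ts) gs b = groundTys-tsubs s n ts gs b
groundTys-tsubs s n []       gs b = _
groundTys-tsubs s n (t ∷ ts) gs b =
  T-∧-intro (groundTy-tsub s n t gs (T-∧ˡ b)) (groundTys-tsubs s n ts gs (T-∧ʳ {tvsBelow n t} b))

groundTy-nth : ∀ τs i d → T (groundTys τs) → T (i <ᵇ length τs) → T (groundTy (fromMaybe d (nth τs i)))
groundTy-nth (τ ∷ τs) zero    d g _ = T-∧ˡ g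
groundTy-nth (τ ∷ τs) (suc i) d g l = groundTy-nth τs i d (T-∧ʳ {groundTy τ} g) l

groundTy-inst : ∀ τs τ → T (groundTys τs) → T (tvsBelow (length τs) τ) → T (groundTy (inst τs τ))
groundTy-inst τs τ g = groundTy-tsub _ (length τs) τ (λ i → groundTy-nth τs i (tv i) g)

eqNs-sound : ∀ ms ns → T (eqNs ms ns) → ms ≡ ns
eqNs-sound []       []       _ = refl
eqNs-sound (m ∷ ms) (n ∷ ns) e = cong₂ _∷_ (≡ᵇ⇒≡ m n (T-∧ˡ e)) (eqNs-sound ms ns (T-∧ʳ {m ≡ᵇ n} e))

eqTy-sound  : ∀ σ τ → T (eqTy σ τ) → σ ≡ τ
eqTys-sound : ∀ σs τs → T (eqTys σs τs) → σs ≡ τs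
eqTy-sound (tv i)    (tv j)    e = cong tv (≡ᵇ⇒≡ i j e)
eqTy-sound (a ⇒ b)   (c ⇒ d)   e = cong₂ _⇒_ (eqTy-sound a c (T-∧ˡ e)) (eqTy-sound b d (T-∧ʳ {eqTy a c} e))
eqTy-sound (tc c ts) (tc d us) e = cong₂ tc (≡ᵇ⇒≡ c d (T-∧ˡ e)) (eqTys-sound ts us (T-∧ʳ {c ≡ᵇ d} e))
eqTys-sound []       []       _ = refl
eqTys-sound (t ∷ ts) (u ∷ us) e = cong₂ _∷_ (eqTy-sound t u (T-∧ˡ e)) (eqTys-sound ts us (T-∧ʳ {eqTy t u} e))

memIntro-sound : ∀ q τ xs → T (memIntro q τ xs) → (q , τ) ∈ xs
memIntro-sound q τ ((p , σ) ∷ xs) m with Equivalence.to (T-∨ {eqNs q p ∧ eqTy τ σ}) m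
... | inj₁ eq = here (cong₂ _,_ (eqNs-sound q p (T-∧ˡ eq)) (eqTy-sound τ σ (T-∧ʳ {eqNs q p} eq)))
... | inj₂ m′ = there (memIntro-sound q τ xs m′)

closedAt-suc  : ∀ d t → T (closedAt d t) → T (closedAt (suc d) t)
closedAts-suc : ∀ d ts → T (closedAts d ts) → T (closedAts (suc d) ts)
closedAtH-suc : ∀ d h → T (closedAtH d h) → T (closedAtH (suc d) h)
closedAt-suc d (lam σ b) c = closedAt-suc (suc d) b c
closedAt-suc d (h · as)  c = T-∧-intro (closedAtH-suc d h (T-∧ˡ c)) (closedAts-suc d as (T-∧ʳ {closedAtH d h} c))
closedAtH-suc d (fv v)       c = _
closedAtH-suc d (bv i)       c = <⇒<ᵇ (m<n⇒m<1+n (<ᵇ⇒< i d c))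
closedAtH-suc d (cn f τs ps) c = closedAts-suc d ps c
closedAts-suc d []       c = _
closedAts-suc d (t ∷ ts) c = T-∧-intro (closedAt-suc d t (T-∧ˡ c)) (closedAts-suc d ts (T-∧ʳ {closedAt d t} c))

closedAt-weaken : ∀ d t → T (closedAt 0 t) → T (closedAt d t)
closedAt-weaken zero    t c = c
closedAt-weaken (suc d) t c = closedAt-suc d t (closedAt-weaken d t c)

closedAt⇒¬occ  : ∀ d k t → T (closedAt d t) → d ≤ k → occ k t ≡ false
closedAts⇒¬occs : ∀ d k ts → T (closedAts d ts) → d ≤ k → occs k ts ≡ false
closedAtH⇒¬occH : ∀ d k h → T (closedAtH d h) → d ≤ k → occH k h ≡ false
closedAt⇒¬occ d k (lam σ b) c d≤k = closedAt⇒¬occ (suc d) (suc k) b c (s≤s d≤k)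
closedAt⇒¬occ d k (h · as)  c d≤k
  rewrite closedAtH⇒¬occH d k h (T-∧ˡ c) d≤k = closedAts⇒¬occs d k as (T-∧ʳ {closedAtH d h} c) d≤k
closedAtH⇒¬occH d k (fv v)       c d≤k = refl
closedAtH⇒¬occH d k (bv i)       c d≤k = ≡ᵇ-false-below i d k c d≤k
closedAtH⇒¬occH d k (cn f τs ps) c d≤k = closedAts⇒¬occs d k ps c d≤k
closedAts⇒¬occs d k []       c d≤k = refl
closedAts⇒¬occs d k (t ∷ ts) c d≤k
  rewrite closedAt⇒¬occ d k t (T-∧ˡ c) d≤k = closedAts⇒¬occs d k ts (T-∧ʳ {closedAt d t} c) d≤k

closed⇒¬isBv0 : ∀ t → T (closedAt 0 t) → isBv0 t ≡ false
closed⇒¬isBv0 (lam σ t)               c = refl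
closed⇒¬isBv0 (fv v · as)             c = refl
closed⇒¬isBv0 (bv zero · [])          ()
closed⇒¬isBv0 (bv zero · (_ ∷ _))     c = refl
closed⇒¬isBv0 (bv (suc i) · as)       c = refl
closed⇒¬isBv0 (cn f τs ps · as)       c = refl

closedAts-initLast : ∀ as {ini l} → initLast as ≡ just (ini , l) → T (closedAts 0 as) → T (closedAt 0 l)
closedAts-initLast (a ∷ [])     refl c = T-∧ˡ c
closedAts-initLast (a ∷ b ∷ as) e    c with initLast (b ∷ as) in e′
closedAts-initLast (a ∷ b ∷ as) refl c | just _ = closedAts-initLast (b ∷ as) e′ (T-∧ʳ {closedAt 0 a} c)

closed⇒¬etaBody : ∀ t → T (closedAt 0 t) → etaBody t ≡ false
closed⇒¬etaBody (lam σ b) c = refl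
closed⇒¬etaBody (h · as)  c with initLast as in e
... | nothing = refl
... | just (ini , l) rewrite closed⇒¬isBv0 l (closedAts-initLast as e (T-∧ʳ {closedAtH 0 h} c)) = refl

-- etaBody (h · as) only asks whether the last argument is the index 0 and whether 0
-- occurs among the other arguments.
AgreeOnIndex0 : PT → PT → Set
AgreeOnIndex0 a a′ = (isBv0 a ≡ isBv0 a′) × (occ 0 a ≡ occ 0 a′)

occs-pointwise : ∀ {as as′} → Pointwise AgreeOnIndex0 as as′ → occs 0 as ≡ occs 0 as′
occs-pointwise []                 = refl
occs-pointwise ((_ , occ≡) ∷ pw) = cong₂ _∨_ occ≡ (occs-pointwise pw)

etaBody-pointwise : ∀ h {as as′} → Pointwise AgreeOnIndex0 as as′ → etaBody (h · as) ≡ etaBody (h · as′)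
etaBody-pointwise h {as} {as′} pw with initLast as | initLast as′ | initLast-pointwise pw
... | just _  | just _  | Maybe.just (inits , (isBv0≡ , _)) =
  cong₂ (λ b o → b ∧ not (occH 0 h ∨ o)) isBv0≡ (occs-pointwise inits)
... | nothing | nothing | Maybe.nothing = refl

etaR-short  : ∀ t → T (short t) → etaR t ≡ t
etaRs-short : ∀ ts → T (shorts ts) → etaRs ts ≡ ts
etaRH-short : ∀ h → T (shortH h) → etaRH h ≡ h
etaR-short (lam σ b) s
  rewrite etaR-short b (T-∧ˡ s) | Equivalence.to T-not-≡ (T-∧ʳ {short b} s) = refl
etaR-short (h · as)  s = cong₂ _·_ (etaRH-short h (T-∧ˡ s)) (etaRs-short as (T-∧ʳ {shortH h} s))
etaRH-short (fv v)       s = refl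
etaRH-short (bv i)       s = refl
etaRH-short (cn f τs ps) s = cong (cn f τs) (etaRs-short ps s)
etaRs-short []       s = refl
etaRs-short (t ∷ ts) s = cong₂ _∷_ (etaR-short t (T-∧ˡ s)) (etaRs-short ts (T-∧ʳ {short t} s))

napp-[] : ∀ τ s → napp τ s [] ≡ s
napp-[] (tv i)    s         = refl
napp-[] (tc c ts) s         = refl
napp-[] (a ⇒ b)   (lam σ t) = refl
napp-[] (a ⇒ b)   (h · as)  = refl

etaExp-nonFun : ∀ τ t → T (nonFun τ) → etaExp τ t ≡ t
etaExp-nonFun (tv i)    t _ = refl
etaExp-nonFun (tc c ts) t _ = refl

applyS-ground  : ∀ S st s t → T (groundT t) → applyS S st s t ≡ t
applySs-ground : ∀ S st s ts → T (groundTs ts) → applySs S st s ts ≡ ts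
applyS-ground S st s (lam σ b) g =
  cong₂ lam (tsub-ground st σ (T-∧ˡ g)) (applyS-ground S st s b (T-∧ʳ {groundTy σ} g))
applyS-ground S st s (fv v · as) ()
applyS-ground S st s (bv i · as) g = cong (bv i ·_) (applySs-ground S st s as g)
applyS-ground S st s (cn f τs ps · as) g =
  cong₂ _·_ (cong₂ (cn f) (tsubs-ground st τs (T-∧ˡ (T-∧ˡ g)))
                          (applySs-ground S st s ps (T-∧ʳ {groundTys τs} (T-∧ˡ g))))
            (applySs-ground S st s as (T-∧ʳ {groundTys τs ∧ groundTs ps} g))
applySs-ground S st s []       g = refl
applySs-ground S st s (t ∷ ts) g =
  cong₂ _∷_ (applyS-ground S st s t (T-∧ˡ g)) (applySs-ground S st s ts (T-∧ʳ {groundT t} g))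

-- Typing

module Typing (S : Signature) where
  open Signature S

  typeOfH-sound : ∀ {ℓ Γ h σ} → Hd S ℓ Γ h σ → typeOfH S Γ h ≡ just σ
  typeOfH-sound fvᵗ       = refl
  typeOfH-sound (bvᵗ e)   = e
  typeOfH-sound (cnᵗ _ _) = refl

  peel-Sp : ∀ {ℓ Γ as σ τ} → Sp S ℓ Γ as σ τ → peel (length as) σ ≡ just τ
  peel-Sp []ᵗ        = refl
  peel-Sp (_ ∷ᵗ sp) = peel-Sp sp

  typeOf-sound : ∀ {ℓ Γ t τ} → Tm S ℓ Γ t τ → typeOf S Γ t ≡ just τ
  typeOf-sound (lamᵗ d) rewrite typeOf-sound d = refl
  typeOf-sound (appᵗ hd sp _) rewrite typeOfH-sound hd = peel-Sp sp

  AgreeBelow : ℕ → List Ty → List Ty → Set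
  AgreeBelow d Γ Γ′ = ∀ i → T (i <ᵇ d) → nth Γ i ≡ nth Γ′ i

  AgreeBelow-∷ : ∀ {d Γ Γ′} σ → AgreeBelow d Γ Γ′ → AgreeBelow (suc d) (σ ∷ Γ) (σ ∷ Γ′)
  AgreeBelow-∷ σ a zero    _ = refl
  AgreeBelow-∷ σ a (suc i) l = a i l

  Tm-agree : ∀ {ℓ d Γ Γ′ t τ} → AgreeBelow d Γ Γ′ → T (closedAt d t)
           → Tm S ℓ Γ t τ → Tm S ℓ Γ′ t τ
  Hd-agree : ∀ {ℓ d Γ Γ′ h τ} → AgreeBelow d Γ Γ′ → T (closedAtH d h)
           → Hd S ℓ Γ h τ → Hd S ℓ Γ′ h τ
  Sp-agree : ∀ {ℓ d Γ Γ′ as σ τ} → AgreeBelow d Γ Γ′ → T (closedAts d as)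
           → Sp S ℓ Γ as σ τ → Sp S ℓ Γ′ as σ τ
  Ps-agree : ∀ {ℓ d Γ Γ′ as σs} → AgreeBelow d Γ Γ′ → T (closedAts d as)
           → Ps S ℓ Γ as σs → Ps S ℓ Γ′ as σs
  Tm-agree a c (lamᵗ d) = lamᵗ (Tm-agree (AgreeBelow-∷ _ a) c d)
  Tm-agree {d = d} a c (appᵗ {h = h} hd sp ok) =
    appᵗ (Hd-agree a (T-∧ˡ c) hd) (Sp-agree a (T-∧ʳ {closedAtH d h} c) sp) ok
  Hd-agree a c fvᵗ                = fvᵗ
  Hd-agree a c (bvᵗ {i = i} e)   = bvᵗ (trans (sym (a i c)) e)
  Hd-agree a c (cnᵗ len ps)       = cnᵗ len (Ps-agree a c ps)
  Sp-agree a c []ᵗ = []ᵗ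
  Sp-agree {d = d} a c (_∷ᵗ_ {a = x} t sp) = Tm-agree a (T-∧ˡ c) t ∷ᵗ Sp-agree a (T-∧ʳ {closedAt d x} c) sp
  Ps-agree a c []ᵗ = []ᵗ
  Ps-agree {d = d} a c (_∷ᵗ_ {a = x} t ps) = Tm-agree a (T-∧ˡ c) t ∷ᵗ Ps-agree a (T-∧ʳ {closedAt d x} c) ps

  Tm-closed : ∀ {ℓ Γ t τ} → Tm S ℓ Γ t τ → T (closedAt (length Γ) t)
  Hd-closed : ∀ {ℓ Γ h τ} → Hd S ℓ Γ h τ → T (closedAtH (length Γ) h)
  Sp-closed : ∀ {ℓ Γ as σ τ} → Sp S ℓ Γ as σ τ → T (closedAts (length Γ) as)
  Ps-closed : ∀ {ℓ Γ as σs} → Ps S ℓ Γ as σs → T (closedAts (length Γ) as)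
  Tm-closed (lamᵗ d)        = Tm-closed d
  Tm-closed (appᵗ hd sp _)  = T-∧-intro (Hd-closed hd) (Sp-closed sp)
  Hd-closed fvᵗ                          = _
  Hd-closed {Γ = Γ} (bvᵗ {i = i} e)      = nth-just⇒<ᵇlength Γ i e
  Hd-closed (cnᵗ _ ps)                   = Ps-closed ps
  Sp-closed []ᵗ        = _
  Sp-closed (t ∷ᵗ sp) = T-∧-intro (Tm-closed t) (Sp-closed sp)
  Ps-closed []ᵗ        = _
  Ps-closed (t ∷ᵗ ps) = T-∧-intro (Tm-closed t) (Ps-closed ps)

  Tm-strengthen : ∀ {ℓ Γ t τ} → T (closedAt 0 t) → Tm S ℓ Γ t τ → Tm S ℓ [] t τ
  Tm-strengthen = Tm-agree {d = 0} (λ _ ())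

  Tm-weaken : ∀ {ℓ Γ t τ} → Tm S ℓ [] t τ → Tm S ℓ Γ t τ
  Tm-weaken d = Tm-agree {d = 0} (λ _ ()) (Tm-closed d) d

  GroundCtx : List Ty → Set
  GroundCtx Γ = ∀ i σ → nth Γ i ≡ just σ → T (groundTy σ)

  GroundCtx-∷ : ∀ {Γ σ} → T (groundTy σ) → GroundCtx Γ → GroundCtx (σ ∷ Γ)
  GroundCtx-∷ g G zero    σ refl = g
  GroundCtx-∷ g G (suc i) σ e    = G i σ e

  Tm-groundTy : ∀ {ℓ Γ t τ} → GroundCtx Γ → T (groundT t) → Tm S ℓ Γ t τ → T (groundTy τ)
  Hd-groundTy : ∀ {ℓ Γ h σ} → GroundCtx Γ → T (groundH h) → Hd S ℓ Γ h σ → T (groundTy σ)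
  Sp-groundTy : ∀ {ℓ Γ as σ τ} → T (groundTy σ) → Sp S ℓ Γ as σ τ → T (groundTy τ)
  Tm-groundTy {t = lam σ b} G g (lamᵗ d) =
    T-∧-intro (T-∧ˡ g) (Tm-groundTy (GroundCtx-∷ (T-∧ˡ g) G) (T-∧ʳ {groundTy σ} g) d)
  Tm-groundTy {t = h · as} G g (appᵗ hd sp _) = Sp-groundTy (Hd-groundTy G (T-∧ˡ g) hd) sp
  Hd-groundTy G g (bvᵗ e) = G _ _ e
  Hd-groundTy G g (cnᵗ {f = f} {τs = τs} len _) =
    groundTy-inst τs (cType f) (T-∧ˡ g) (subst (λ n → T (tvsBelow n (cType f))) (sym len) (cType-wf f))
  Sp-groundTy gσ []ᵗ = gσ
  Sp-groundTy {σ = σ ⇒ _} gσ (_ ∷ᵗ sp) = Sp-groundTy (T-∧ʳ {groundTy σ} gσ) sp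

  yellowNF-closed : ∀ {t a} → yellowNF S t ≡ just a → T (closedAt 0 t)
  yellowNF-closed {t} e with closedAt 0 t
  yellowNF-closed {t} e  | true = _
  yellowNF-closed {t} () | false

  yellowNF-typeOf : ∀ {t} → T (closedAt 0 t) → yellowNF S t ≡ (typeOf S [] t >>= nonFunTy)
  yellowNF-typeOf {t} c  with closedAt 0 t
  yellowNF-typeOf {t} c  | true = refl
  yellowNF-typeOf {t} () | false

  yellowNF-typed : ∀ {ℓ Γ t τ} → T (closedAt 0 t) → Tm S ℓ Γ t τ → yellowNF S t ≡ nonFunTy τ
  yellowNF-typed {t = t} c d = trans (yellowNF-typeOf {t} c) (cong (_>>= nonFunTy) (typeOf-sound (Tm-strengthen c d)))

  yellowNF-type : ∀ {ℓ Γ t τ τ₀ pf} → Tm S ℓ Γ t τ → yellowNF S t ≡ just (τ₀ , pf) → τ₀ ≡ τ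
  yellowNF-type {t = t} {τ} d e = nonFunTy-just τ (trans (sym (yellowNF-typed (yellowNF-closed {t} e) d)) e)
    where
      nonFunTy-just : ∀ τ {τ₀ pf} → nonFunTy τ ≡ just (τ₀ , pf) → τ₀ ≡ τ
      nonFunTy-just (tv i)    refl = refl
      nonFunTy-just (tc c ts) refl = refl

  yellowNF-groundTy : ∀ {ℓ Γ t τ τ₀ pf} → T (groundT t) → Tm S ℓ Γ t τ → yellowNF S t ≡ just (τ₀ , pf)
                    → T (groundTy τ)
  yellowNF-groundTy {t = t} g d e = Tm-groundTy (λ _ _ ()) g (Tm-strengthen (yellowNF-closed {t} e) d)

  yellowNF-cong : ∀ {ℓ Γ t t′ τ} → Tm S ℓ Γ t τ → Tm S ℓ Γ t′ τ → closedAt 0 t ≡ closedAt 0 t′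
                → yellowNF S t ≡ yellowNF S t′
  yellowNF-cong {t = t} {t′} d d′ e with closedAt 0 t in c | closedAt 0 t′ in c′
  ... | true  | true  = cong (_>>= nonFunTy) (trans (typeOf-sound (Tm-strengthen (≡true⇒T c) d))
                                                 (sym (typeOf-sound (Tm-strengthen (≡true⇒T c′) d′))))
  ... | false | false = refl
  yellowNF-cong d d′ () | true  | false
  yellowNF-cong d d′ () | false | true

  longify-long  : ∀ {Γ t τ} → Tm S true Γ t τ → longify S Γ t ≡ t
  longifyH-long : ∀ {Γ h τ} → Hd S true Γ h τ → longifyH S Γ h ≡ h
  longifys-Sp   : ∀ {Γ as σ τ} → Sp S true Γ as σ τ → longifys S Γ as ≡ as
  longifys-Ps   : ∀ {Γ as σs} → Ps S true Γ as σs → longifys S Γ as ≡ as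
  longify-long (lamᵗ d) = cong (lam _) (longify-long d)
  longify-long (appᵗ hd sp nonFun-τ)
    rewrite typeOf-sound (appᵗ hd sp nonFun-τ) | longifyH-long hd | longifys-Sp sp = etaExp-nonFun _ _ nonFun-τ
  longifyH-long fvᵗ          = refl
  longifyH-long (bvᵗ e)      = refl
  longifyH-long (cnᵗ _ ps)   = cong (cn _ _) (longifys-Ps ps)
  longifys-Sp []ᵗ        = refl
  longifys-Sp (d ∷ᵗ sp) = cong₂ _∷_ (longify-long d) (longifys-Sp sp)
  longifys-Ps []ᵗ        = refl
  longifys-Ps (d ∷ᵗ ps) = cong₂ _∷_ (longify-long d) (longifys-Ps ps)

-- Replacing outermost nonfunctional yellow subterms

module Replace (S : Signature) (y : ℕ) (r : VPG → PT) (r-closed : ∀ v → T (closedAt 0 (r v))) where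
  open Typing S

  replace     : List ℕ → PT → PT
  replaceIn   : List ℕ → PT → PT
  replaceArgs : List ℕ → ℕ → List PT → List PT
  replace p t = choose (yellowNF S t) (λ { (τ , pf) → r (sub y p τ pf) }) (replaceIn p t)
  replaceIn p (lam σ b)         = lam σ (replace (p ∷ʳ 1) b)
  replaceIn p (bv i · as)       = bv i · replaceArgs p 1 as
  replaceIn p (cn f τs ps · as) = cn f τs ps · replaceArgs p 1 as
  replaceIn p (fv v · as)       = fv v · as
  replaceArgs p n []       = []
  replaceArgs p n (a ∷ as) = replace (p ∷ʳ n) a ∷ replaceArgs p (suc n) as

  applyS-abstr     : ∀ st p t → T (groundT t) → applyS S st r (abstr S y p t) ≡ replace p t
  applyS-abstrIn   : ∀ st p t → T (groundT t) → applyS S st r (abstrIn S y p t) ≡ replaceIn p t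
  applyS-abstrArgs : ∀ st p n as → T (groundTs as) → applySs S st r (abstrArgs S y p n as) ≡ replaceArgs p n as
  applyS-abstr st p t g with yellowNF S t
  ... | just (τ , pf) = napp-[] (tsub st τ) (r (sub y p τ pf))
  ... | nothing       = applyS-abstrIn st p t g
  applyS-abstrIn st p (lam σ b) g =
    cong₂ lam (tsub-ground st σ (T-∧ˡ g)) (applyS-abstr st (p ∷ʳ 1) b (T-∧ʳ {groundTy σ} g))
  applyS-abstrIn st p (fv v · as) ()
  applyS-abstrIn st p (bv i · as) g = cong (bv i ·_) (applyS-abstrArgs st p 1 as g)
  applyS-abstrIn st p (cn f τs ps · as) g =
    cong₂ _·_ (cong₂ (cn f) (tsubs-ground st τs (T-∧ˡ (T-∧ˡ g)))
                            (applySs-ground S st r ps (T-∧ʳ {groundTys τs} (T-∧ˡ g))))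
              (applyS-abstrArgs st p 1 as (T-∧ʳ {groundTys τs ∧ groundTs ps} g))
  applyS-abstrArgs st p n []       g = refl
  applyS-abstrArgs st p n (a ∷ as) g =
    cong₂ _∷_ (applyS-abstr st (p ∷ʳ n) a (T-∧ˡ g)) (applyS-abstrArgs st p (suc n) as (T-∧ʳ {groundT a} g))

  replace-closedAt      : ∀ d p t → closedAt d (replace p t) ≡ closedAt d t
  replaceIn-closedAt    : ∀ d p t → closedAt d (replaceIn p t) ≡ closedAt d t
  replaceArgs-closedAts : ∀ d p n as → closedAts d (replaceArgs p n as) ≡ closedAts d as
  replace-closedAt d p t with yellowNF S t in e
  ... | just (τ , pf) = trans (T⇒≡true (closedAt-weaken d (r (sub y p τ pf)) (r-closed _)))
                              (sym (T⇒≡true (closedAt-weaken d t (yellowNF-closed {t} e))))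
  ... | nothing       = replaceIn-closedAt d p t
  replaceIn-closedAt d p (lam σ b)         = replace-closedAt (suc d) (p ∷ʳ 1) b
  replaceIn-closedAt d p (bv i · as)       = cong ((i <ᵇ d) ∧_) (replaceArgs-closedAts d p 1 as)
  replaceIn-closedAt d p (cn f τs ps · as) = cong (closedAts d ps ∧_) (replaceArgs-closedAts d p 1 as)
  replaceIn-closedAt d p (fv v · as)       = refl
  replaceArgs-closedAts d p n []       = refl
  replaceArgs-closedAts d p n (a ∷ as) =
    cong₂ _∧_ (replace-closedAt d (p ∷ʳ n) a) (replaceArgs-closedAts d p (suc n) as)

  replace-occ      : ∀ k p t → occ k (replace p t) ≡ occ k t
  replaceIn-occ    : ∀ k p t → occ k (replaceIn p t) ≡ occ k t
  replaceArgs-occs : ∀ k p n as → occs k (replaceArgs p n as) ≡ occs k as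
  replace-occ k p t with yellowNF S t in e
  ... | just (τ , pf) = trans (closedAt⇒¬occ 0 k (r (sub y p τ pf)) (r-closed _) z≤n)
                              (sym (closedAt⇒¬occ 0 k t (yellowNF-closed {t} e) z≤n))
  ... | nothing       = replaceIn-occ k p t
  replaceIn-occ k p (lam σ b)         = replace-occ (suc k) (p ∷ʳ 1) b
  replaceIn-occ k p (bv i · as)       = cong ((i ≡ᵇ k) ∨_) (replaceArgs-occs k p 1 as)
  replaceIn-occ k p (cn f τs ps · as) = cong (occs k ps ∨_) (replaceArgs-occs k p 1 as)
  replaceIn-occ k p (fv v · as)       = refl
  replaceArgs-occs k p n []       = refl
  replaceArgs-occs k p n (a ∷ as) = cong₂ _∨_ (replace-occ k (p ∷ʳ n) a) (replaceArgs-occs k p (suc n) as)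

  replace-isBv0 : ∀ p t → isBv0 (replace p t) ≡ isBv0 t
  replace-isBv0 p t with yellowNF S t in e
  ... | just (τ , pf) = trans (closed⇒¬isBv0 (r (sub y p τ pf)) (r-closed _))
                              (sym (closed⇒¬isBv0 t (yellowNF-closed {t} e)))
  ... | nothing       = replaceIn-isBv0 t
    where
      replaceIn-isBv0 : ∀ t → isBv0 (replaceIn p t) ≡ isBv0 t
      replaceIn-isBv0 (lam σ b)             = refl
      replaceIn-isBv0 (bv zero · [])        = refl
      replaceIn-isBv0 (bv zero · (_ ∷ _))   = refl
      replaceIn-isBv0 (bv (suc i) · as)     = refl
      replaceIn-isBv0 (cn f τs ps · as)     = refl
      replaceIn-isBv0 (fv v · as)           = refl

  replaceArgs-agree : ∀ p n as → Pointwise AgreeOnIndex0 (replaceArgs p n as) as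
  replaceArgs-agree p n []       = []
  replaceArgs-agree p n (a ∷ as) =
    (replace-isBv0 (p ∷ʳ n) a , replace-occ 0 (p ∷ʳ n) a) ∷ replaceArgs-agree p (suc n) as

  replace-etaBody : ∀ p t → etaBody (replace p t) ≡ etaBody t
  replace-etaBody p t with yellowNF S t in e
  ... | just (τ , pf) = trans (closed⇒¬etaBody (r (sub y p τ pf)) (r-closed _))
                              (sym (closed⇒¬etaBody t (yellowNF-closed {t} e)))
  ... | nothing       = replaceIn-etaBody t
    where
      replaceIn-etaBody : ∀ t → etaBody (replaceIn p t) ≡ etaBody t
      replaceIn-etaBody (lam σ b)         = refl
      replaceIn-etaBody (bv i · as)       = etaBody-pointwise (bv i) (replaceArgs-agree p 1 as)
      replaceIn-etaBody (cn f τs ps · as) = etaBody-pointwise (cn f τs ps) (replaceArgs-agree p 1 as)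
      replaceIn-etaBody (fv v · as)       = refl

  module _ (r-short : ∀ v → T (short (r v))) where
    replace-short      : ∀ p t → T (short t) → T (short (replace p t))
    replaceIn-short    : ∀ p t → T (short t) → T (short (replaceIn p t))
    replaceArgs-shorts : ∀ p n as → T (shorts as) → T (shorts (replaceArgs p n as))
    replace-short p t s with yellowNF S t
    ... | just _  = r-short _
    ... | nothing = replaceIn-short p t s
    replaceIn-short p (lam σ b) s =
      T-∧-intro (replace-short (p ∷ʳ 1) b (T-∧ˡ s))
                (subst (λ e → T (not e)) (sym (replace-etaBody (p ∷ʳ 1) b)) (T-∧ʳ {short b} s))
    replaceIn-short p (bv i · as)       s = replaceArgs-shorts p 1 as s
    replaceIn-short p (cn f τs ps · as) s = T-∧-intro (T-∧ˡ s) (replaceArgs-shorts p 1 as (T-∧ʳ {shorts ps} s))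
    replaceIn-short p (fv v · as)       s = s
    replaceArgs-shorts p n []       s = _
    replaceArgs-shorts p n (a ∷ as) s =
      T-∧-intro (replace-short (p ∷ʳ n) a (T-∧ˡ s)) (replaceArgs-shorts p (suc n) as (T-∧ʳ {short a} s))

  module _ {ℓ} (r-typed : ∀ q τ pf → T (groundTy τ) → Tm S ℓ [] (r (sub y q τ pf)) τ) where
    Tm-replacement : ∀ {Γ t τ τ₀} p pf → T (groundT t) → Tm S ℓ Γ t τ → yellowNF S t ≡ just (τ₀ , pf)
                   → Tm S ℓ Γ (r (sub y p τ₀ pf)) τ
    Tm-replacement {t = t} p pf g d e with yellowNF-type {t = t} d e
    ... | refl = Tm-weaken (r-typed p _ pf (yellowNF-groundTy g d e))

    Tm-replace     : ∀ {Γ t τ} p → T (groundT t) → Tm S ℓ Γ t τ → Tm S ℓ Γ (replace p t) τ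
    Tm-replaceIn   : ∀ {Γ t τ} p → T (groundT t) → Tm S ℓ Γ t τ → Tm S ℓ Γ (replaceIn p t) τ
    Sp-replaceArgs : ∀ {Γ as σ τ} p n → T (groundTs as) → Sp S ℓ Γ as σ τ
                   → Sp S ℓ Γ (replaceArgs p n as) σ τ
    Tm-replace {t = t} p g d with yellowNF S t in e
    ... | just (_ , pf) = Tm-replacement p pf g d e
    ... | nothing       = Tm-replaceIn p g d
    Tm-replaceIn p g (lamᵗ {σ = σ} d)          = lamᵗ (Tm-replace (p ∷ʳ 1) (T-∧ʳ {groundTy σ} g) d)
    Tm-replaceIn p g (appᵗ fvᵗ sp ok)         = appᵗ fvᵗ sp ok
    Tm-replaceIn p g (appᵗ (bvᵗ e) sp ok)     = appᵗ (bvᵗ e) (Sp-replaceArgs p 1 g sp) ok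
    Tm-replaceIn p g (appᵗ (cnᵗ {τs = τs} {ps = ps} len ps′) sp ok) =
      appᵗ (cnᵗ len ps′) (Sp-replaceArgs p 1 (T-∧ʳ {groundTys τs ∧ groundTs ps} g) sp) ok
    Sp-replaceArgs p n g []ᵗ = []ᵗ
    Sp-replaceArgs p n g (_∷ᵗ_ {a = a} d sp) =
      Tm-replace (p ∷ʳ n) (T-∧ˡ g) d ∷ᵗ Sp-replaceArgs p (suc n) (T-∧ʳ {groundT a} g) sp

  module _ (r-typed : ∀ q τ pf → T (groundTy τ) → Tm S false [] (r (sub y q τ pf)) τ) where
    ony-replace     : ∀ {Γ t τ} p → T (groundT t) → Tm S false Γ t τ → ony S p (replace p t) ≡ ony S p t
    onyIn-replace   : ∀ {Γ t τ} p → T (groundT t) → Tm S false Γ t τ → onyIn S p (replaceIn p t) ≡ onyIn S p t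
    onyArgs-replace : ∀ {Γ as σ τ} p n → T (groundTs as) → Sp S false Γ as σ τ
                    → onyArgs S p n (replaceArgs p n as) ≡ onyArgs S p n as
    ony-replace {t = t} p g d with yellowNF S t in e
    ... | just (τ₀ , pf)
      rewrite yellowNF-cong (Tm-replacement r-typed p pf g d e) d
                (trans (T⇒≡true (r-closed _)) (sym (T⇒≡true (yellowNF-closed {t} e))))
            | e = refl
    ... | nothing
      rewrite yellowNF-cong (Tm-replaceIn r-typed p g d) d (replaceIn-closedAt 0 p t) | e =
        onyIn-replace p g d
    onyIn-replace p g (lamᵗ {σ = σ} d)      = ony-replace (p ∷ʳ 1) (T-∧ʳ {groundTy σ} g) d
    onyIn-replace p g (appᵗ fvᵗ sp ok)     = refl
    onyIn-replace p g (appᵗ (bvᵗ e) sp ok) = onyArgs-replace p 1 g sp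
    onyIn-replace p g (appᵗ (cnᵗ {τs = τs} {ps = ps} _ _) sp ok) =
      onyArgs-replace p 1 (T-∧ʳ {groundTys τs ∧ groundTs ps} g) sp
    onyArgs-replace p n g []ᵗ = refl
    onyArgs-replace p n g (_∷ᵗ_ {a = a} d sp) =
      cong₂ _++_ (ony-replace (p ∷ʳ n) (T-∧ˡ g) d) (onyArgs-replace p (suc n) (T-∧ʳ {groundT a} g) sp)

  at-replace : ∀ p t {q τ} → (q , τ) ∈ ony S p t → (pf : T (nonFun τ))
             → ∃[ s ] q ≡ p ++ s × replace p t at s ≡ just (r (sub y q τ pf))
  at-replaceIn : ∀ p t {q τ} → (q , τ) ∈ onyIn S p t → (pf : T (nonFun τ))
               → ∃[ s ] q ≡ p ++ s × replaceIn p t at s ≡ just (r (sub y q τ pf))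
  at-replaceArgs : ∀ p n as {q τ} → (q , τ) ∈ onyArgs S p n as → (pf : T (nonFun τ))
                 → ∃[ j ] ∃[ s ] q ≡ p ++ (n + j ∷ s)
                     × (nth (replaceArgs p n as) j >>= _at s) ≡ just (r (sub y q τ pf))
  at-replace p t q∈ pf with yellowNF S t
  ... | just (τ₀ , pf₀) with q∈
  ...   | here refl = [] , sym (++-identityʳ p) , cong (λ pf → just (r (sub y p τ₀ pf))) (T-irrelevant pf₀ pf)
  at-replace p t q∈ pf | nothing = at-replaceIn p t q∈ pf
  at-replaceIn p (lam σ b) q∈ pf with at-replace (p ∷ʳ 1) b q∈ pf
  ... | s , refl , at = 1 ∷ s , ++-assoc p (1 ∷ []) s , at
  at-replaceIn p (bv i · as) q∈ pf with at-replaceArgs p 1 as q∈ pf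
  ... | j , s , refl , at = suc j ∷ s , refl , at
  at-replaceIn p (cn f τs ps · as) q∈ pf with at-replaceArgs p 1 as q∈ pf
  ... | j , s , refl , at = suc j ∷ s , refl , at
  at-replaceArgs p n (a ∷ as) q∈ pf with ∈-++⁻ (ony S (p ∷ʳ n) a) q∈
  ... | inj₁ q∈a with at-replace (p ∷ʳ n) a q∈a pf
  ...   | s , refl , at =
    0 , s , trans (++-assoc p (n ∷ []) s) (cong (λ i → p ++ (i ∷ s)) (sym (+-identityʳ n))) , at
  at-replaceArgs p n (a ∷ as) q∈ pf | inj₂ q∈as with at-replaceArgs p (suc n) as q∈as pf
  ...   | j , s , refl , at = suc j , s , cong (λ i → p ++ (i ∷ s)) (sym (+-suc n j)) , at

-- The composition 𝔭(θ)ρ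

module _ (S : Signature) where
  open Typing S

  GroundingPG-closed : ∀ {m ρ} → GroundingPG S m ρ → ∀ v → T (closedAt 0 (tm ρ v))
  GroundingPG-closed (_ , ρ-ground) v = let (_ , _ , typed , _) = ρ-ground v in Tm-closed typed

  GroundingPG-sub : ∀ {m ρ} → GroundingPG S m ρ → ∀ y q τ pf → T (groundTy τ)
                  → GroundTerm S m (tm ρ (sub y q τ pf)) τ
  GroundingPG-sub {m} (_ , ρ-ground) y q τ pf gτ =
    subst (GroundTerm S m _) (tsub-ground _ τ gτ) (ρ-ground (sub y q τ pf))

  nf-replace : ∀ m {θ ρ} → GroundingH S m θ → (ρ-ground : GroundingPG S m ρ) → ∀ y
             → let open Replace S y (tm ρ) (GroundingPG-closed {m} ρ-ground)
               in nf S m (replace [] (tm θ y)) ≡ replace [] (tm θ y)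
  nf-replace long {ρ = ρ} (_ , θ-ground) ρ-ground y =
    let (_ , θy-ground , _ , θy-long) = θ-ground y
    in longify-long (Tm-replace ρ-long [] θy-ground θy-long)
    where
      open Replace S y (tm ρ) (GroundingPG-closed {long} ρ-ground)
      ρ-long : ∀ q τ pf → T (groundTy τ) → Tm S true [] (tm ρ (sub y q τ pf)) τ
      ρ-long q τ pf gτ = let (_ , _ , _ , v-long) = GroundingPG-sub {long} ρ-ground y q τ pf gτ in v-long
  nf-replace short′ {θ} {ρ} (_ , θ-ground) ρ-ground@(_ , ρ-terms) y =
    let (_ , _ , _ , θy-short) = θ-ground y
    in etaR-short _ (replace-short ρ-short [] (tm θ y) θy-short)
    where
      open Replace S y (tm ρ) (GroundingPG-closed {short′} ρ-ground)
      ρ-short : ∀ v → T (short (tm ρ v))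
      ρ-short v = let (_ , _ , _ , v-short) = ρ-terms v in v-short

module Composition (S : Signature) (m : Mode)
                   (θ : Subst ℕ) (θ-ground : GroundingH S m θ)
                   (ρ : Subst VPG) (ρ-ground : GroundingPG S m ρ) where
  open ≡-Reasoning
  module Replaceρ (y : ℕ) = Replace S y (tm ρ) (GroundingPG-closed S {m} ρ-ground)

  θρ : Subst ℕ
  θρ = compose S m (𝔭 S θ) ρ

  θ-groundT : ∀ y → T (groundT (tm θ y))
  θ-groundT y = let (_ , θy-ground , _ , _) = proj₂ θ-ground y in θy-ground

  θ-typed : ∀ y → Tm S false [] (tm θ y) (tsub (ty θ) (Signature.tyH S y))
  θ-typed y = let (_ , _ , θy-typed , _) = proj₂ θ-ground y in θy-typed

  ρ-sub-typed : ∀ y q τ pf → T (groundTy τ) → Tm S false [] (tm ρ (sub y q τ pf)) τ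
  ρ-sub-typed y q τ pf gτ = let (_ , _ , typed , _) = GroundingPG-sub S {m} ρ-ground y q τ pf gτ in typed

  ty-θρ : ∀ α → ty θρ α ≡ ty θ α
  ty-θρ α = tsub-ground (ty ρ) (ty θ α) (proj₁ θ-ground α)

  tm-θρ : ∀ y → tm θρ y ≡ Replaceρ.replace y [] (tm θ y)
  tm-θρ y = begin
    nf S m (applyS S (ty ρ) (tm ρ) (abstr S y [] (tm θ y)))
      ≡⟨ cong (nf S m) (Replaceρ.applyS-abstr y (ty ρ) [] (tm θ y) (θ-groundT y)) ⟩
    nf S m (Replaceρ.replace y [] (tm θ y))
      ≡⟨ nf-replace S m θ-ground ρ-ground y ⟩
    Replaceρ.replace y [] (tm θ y) ∎

  ony-θρ : ∀ y → ony S [] (tm θρ y) ≡ ony S [] (tm θ y)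
  ony-θρ y = trans (cong (ony S []) (tm-θρ y))
                   (Replaceρ.ony-replace y (ρ-sub-typed y) [] (θ-groundT y) (θ-typed y))

  isIntro-θρ : ∀ v → isIntro S θρ v ≡ isIntro S θ v
  isIntro-θρ (base y)      = refl
  isIntro-θρ (sub y p τ _) = cong (memIntro p τ) (ony-θρ y)

  at-θρ : ∀ y p τ pf → Introduced S θ (sub y p τ pf) → tm θρ y at p ≡ just (tm ρ (sub y p τ pf))
  at-θρ y p τ pf intro with Replaceρ.at-replace y [] (tm θ y) (memIntro-sound p τ _ intro) pf
  ... | s , refl , at = trans (cong (_at s) (tm-θρ y)) at

lemma5p14 : (S : Signature) (m : Mode) (dflt : VPG → Ty → PT)
    → ((v : VPG) (τ : Ty) → T (groundTy τ) → GroundTerm S m (dflt v τ) τ)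
    → (θ : Subst ℕ) → GroundingH S m θ
    → (ρ : Subst VPG) → GroundingPG S m ρ
    → ((α : ℕ) → ty ρ α ≡ ty (𝔮 S dflt θ) α)
    → ((v : VPG) → ¬ Introduced S θ v → tm ρ v ≡ tm (𝔮 S dflt θ) v)
    → 𝔮 S dflt (compose S m (𝔭 S θ) ρ) ≐ ρ
-- The defaults are only ever compared with each other, so their groundness is not needed.
lemma5p14 S m dflt _ θ θ-ground ρ ρ-ground ty-agree tm-agree = 𝔮-ty , 𝔮-tm
  where
    open Composition S m θ θ-ground ρ ρ-ground
    open ≡-Reasoning

    𝔮-ty : ∀ α → ty θρ α ≡ ty ρ α
    𝔮-ty α = trans (ty-θρ α) (sym (ty-agree α))

    𝔮-tm : ∀ v → tm (𝔮 S dflt θρ) v ≡ tm ρ v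
    𝔮-tm v@(base y) = begin
      dflt v (tsub (ty θρ) (Signature.tyH S y)) ≡⟨ cong (dflt v) (tsub-cong ty-θρ (Signature.tyH S y)) ⟩
      dflt v (tsub (ty θ) (Signature.tyH S y))  ≡⟨ sym (tm-agree v λ ()) ⟩
      tm ρ v                                    ∎
    𝔮-tm v@(sub y p τ pf) rewrite isIntro-θρ v | tsub-cong ty-θρ τ
      with isIntro S θ v | at-θρ y p τ pf | tm-agree v
    ... | true  | at-p | _     = cong (fromMaybe _) (at-p _)
    ... | false | _    | agree = sym (agree λ ())
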